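{- If $X$ is a distance-regular, non-bipartite graph with no triangles, then $X$ is a core.
   Context: A (connected) graph of diameter $d$ is distance regular if there are constants $p_{ij}^k$ ($0\le i,j,k\le d$) such that for any two vertices $v,w$ at distance $k$ there are exactly $p_{ij}^k$ vertices at distance $i$ from $v$ and distance $j$ from $w$. A graph is a core if every endomorphism (homomorphism from the graph to itself) is an automorphism. -}

module Defs where

open import Data.Nat using (ℕ; zero; suc)
open import Data.Bool using (Bool; true; false; _∧_; _∨_; not; T)
open import Data.Fin using (Fin)
open import Data.Fin.Properties using (_≟_)
open import Data.List using (List; filter; length; allFin)
open import Data.Bool.ListAction using (any)
open import Data.Product using (Σ; ∃; _×_; _,_)
open import Relation.Nullary using (¬_; does)
open import Relation.Binary.PropositionalEquality using (_≡_; _≢_)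
open import Function.Definitions using (Bijective)

record Graph : Set where
  field
    n     : ℕ
    adj   : Fin n → Fin n → Bool
    sym   : ∀ u v → adj u v ≡ adj v u
    loopless : ∀ v → adj v v ≡ false

module _ (X : Graph) where
  open Graph X

  -- within k v w = true iff there is a walk of length at most k from v to w
  within : ℕ → Fin n → Fin n → Bool
  within zero    v w = does (v ≟ w)
  within (suc k) v w = within k v w ∨ any (λ u → within k v u ∧ adj u w) (allFin n)

  isDist : Fin n → Fin n → ℕ → Bool
  isDist v w zero    = within zero v w
  isDist v w (suc i) = within (suc i) v w ∧ not (within i v w)

  count : Fin n → Fin n → ℕ → ℕ → ℕ
  count v w i j = length (filter (λ u → T? (isDist v u i ∧ isDist w u j)) (allFin n))
    where
    open import Data.Bool.Properties using (T?)

  Connected : Set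
  Connected = ∀ v w → ∃ λ k → T (within k v w)

  DistanceRegular : Set
  DistanceRegular =
    Connected ×
    (Σ (ℕ → ℕ → ℕ → ℕ) λ p →
       ∀ (i j k : ℕ) (v w : Fin n) → T (isDist v w k) → count v w i j ≡ p i j k)

  Bipartite : Set
  Bipartite = Σ (Fin n → Bool) λ c → ∀ u v → T (adj u v) → c u ≢ c v

  TriangleFree : Set
  TriangleFree = ∀ u v w → ¬ (T (adj u v) × T (adj v w) × T (adj u w))

  IsEndomorphism : (Fin n → Fin n) → Set
  IsEndomorphism f = ∀ u v → T (adj u v) → T (adj (f u) (f v))

  IsAutomorphism : (Fin n → Fin n) → Set
  IsAutomorphism f = Bijective _≡_ _≡_ f × (∀ u v → adj (f u) (f v) ≡ adj u v)

  IsCore : Set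
  IsCore = ∀ f → IsEndomorphism f → IsAutomorphism f

module Submission where

-- Being connected and non-bipartite, X has odd closed walks; let L be the least length
-- of one (the odd girth). As X is loopless and triangle-free, L = 2k + 3 with k ≥ 1. On a
-- shortest odd closed walk the shorter of two complementary arcs is a geodesic, which
-- yields vertices c′, c at distance 2 and z at distance k from c′ and k + 1 from c. By
-- distance-regularity every pair a, b at distance 2 has such a vertex, so a and b are
-- joined by a walk of odd length 2k + 1 < L, and an endomorphism identifying a and b would
-- create an odd closed walk shorter than L. Distinct common neighbours being at distance 2,
-- every endomorphism f is injective on neighbourhoods. X is regular, so counting shows that
-- f maps each neighbourhood onto a neighbourhood; by connectedness f is onto, hence a
-- bijection of the finite vertex set, and it reflects adjacency: f is an automorphism.

open import Defs
open import Data.Nat using (ℕ; zero; suc; _+_; _≤_; _<_; z≤n; s≤s; s≤s⁻¹; parity)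
open import Data.Nat.Properties
  using (≤-refl; ≤-reflexive; ≤-trans; ≤-antisym; m≤n⇒m≤1+n; m≤n⇒m<n∨m≡n; m<1+n⇒m<n∨m≡n;
         ≮⇒≥; ≰⇒>; <⇒≱; <-irrefl;
         +-comm; +-suc; +-cancelʳ-≤; +-cancelˡ-≤; m≤m+n; m≤n+m; n≤1+n)
open import Data.Nat.Tactic.RingSolver using (solve-∀)
open import Data.Parity.Base as ℙ using (Parity; 0ℙ; 1ℙ; _⁻¹)
open import Data.Parity.Properties using () renaming (_≟_ to _ℙ≟_)
open import Data.Parity.Properties using (+-homo-+; p+p≡0ℙ; p+p⁻¹≡1ℙ)
import Data.Bool as Bool
open import Data.Bool using (Bool; true; false; not; T; _∧_)
open import Data.Empty using (⊥-elim)
open import Data.Bool.Properties using (T?; T-≡; T-∧; T-∨)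
open import Data.Fin as Fin using (Fin)
open import Data.Fin.Properties using (_≟_; any?)
open import Data.List using (List; []; _∷_; allFin; filter; length; map)
open import Data.List.Properties using (filter-notAll; filter-some; filter-≐; length-map)
open import Data.List.Relation.Unary.Any as Any using (here; there)
open import Data.List.Relation.Unary.All as All using (lookup)
open import Data.List.Relation.Unary.AllPairs using ([]; _∷_)
open import Data.List.Relation.Unary.Any.Properties using (any⁺; any⁻)
open import Data.List.Relation.Unary.All.Properties using (¬Any⇒All¬; map⁺)
open import Data.List.Relation.Unary.Unique.Propositional using (Unique)
import Data.List.Relation.Unary.Unique.Propositional.Properties as Unique
open import Data.List.Membership.Propositional using (_∈_; lose)
open import Data.List.Membership.Propositional.Properties using (∈-filter⁺; ∈-filter⁻; ∈-map⁻; ∈-allFin)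
open import Data.List.Relation.Binary.Subset.Propositional using (_⊆_)
open import Data.Product using (∃; _×_; _,_; proj₁; proj₂)
open import Data.Sum as Sum using (_⊎_; inj₁; inj₂; [_,_])
open import Function using (_∘_; id; Equivalence)
open import Function.Consequences.Propositional using (strictlySurjective⇒surjective)
open import Relation.Nullary using (¬_; Dec; yes; no; contradiction)
import Relation.Nullary.Decidable as Dec
open import Relation.Nullary.Decidable using (_×-dec_; dec-true)
open import Relation.Unary using (Decidable)
open import Relation.Binary.Definitions using (DecidableEquality)
open import Relation.Binary.PropositionalEquality
  using (_≡_; _≢_; refl; sym; trans; cong; cong₂; subst; subst₂; module ≡-Reasoning)

module Counting {A : Set} (_≟_ : DecidableEquality A) where
  open import Data.List.Membership.DecPropositional _≟_ using (_∈?_)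
  open import Relation.Nullary using (¬?)

  unique-⊆⇒length≤ : ∀ {xs ys : List A} → Unique xs → xs ⊆ ys → length xs ≤ length ys
  unique-⊆⇒length≤ {[]}     _            _      = z≤n
  unique-⊆⇒length≤ {x ∷ xs} {ys} (x∉xs ∷ uxs) xs⊆ys =
    ≤-trans (s≤s (unique-⊆⇒length≤ uxs xs⊆ys-x))
            (filter-notAll (¬? ∘ (x ≟_)) ys (Any.map (λ eq x≢ → x≢ eq) (xs⊆ys (here refl))))
    where
    xs⊆ys-x : xs ⊆ filter (¬? ∘ (x ≟_)) ys
    xs⊆ys-x y∈xs = ∈-filter⁺ (¬? ∘ (x ≟_)) (xs⊆ys (there y∈xs)) (lookup x∉xs y∈xs)

  InjectiveOn : (A → A) → List A → Set
  InjectiveOn h xs = ∀ {a b} → a ∈ xs → b ∈ xs → h a ≡ h b → a ≡ b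

  map-unique : ∀ (h : A → A) {xs} → Unique xs → InjectiveOn h xs → Unique (map h xs)
  map-unique h {[]}     _            _   = []
  map-unique h {x ∷ xs} (x∉xs ∷ uxs) inj =
    map⁺ (All.tabulate λ y∈xs hx≡hy → lookup x∉xs y∈xs (inj (here refl) (there y∈xs) hx≡hy))
    ∷ map-unique h uxs (λ a∈ b∈ → inj (there a∈) (there b∈))

  injectiveOn⇒covers : ∀ (h : A → A) {xs ys} → Unique xs → InjectiveOn h xs →
                       (∀ {x} → x ∈ xs → h x ∈ ys) → length ys ≤ length xs →
                       ∀ {y} → y ∈ ys → ∃ λ x → x ∈ xs × h x ≡ y
  injectiveOn⇒covers h {xs} {ys} uxs inj into short {y} y∈ys with y ∈? map h xs
  ... | yes y∈hxs with x , x∈xs , y≡hx ← ∈-map⁻ h y∈hxs = x , x∈xs , sym y≡hx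
  ... | no  y∉hxs = contradiction tooLong (<-irrefl refl)
    where
    y∷hxs⊆ys : (y ∷ map h xs) ⊆ ys
    y∷hxs⊆ys (here refl) = y∈ys
    y∷hxs⊆ys (there z∈hxs) with x , x∈xs , refl ← ∈-map⁻ h z∈hxs = into x∈xs

    tooLong : length xs < length xs
    tooLong = ≤-trans (subst (λ ℓ → suc ℓ ≤ length ys) (length-map h xs)
                        (unique-⊆⇒length≤ (¬Any⇒All¬ _ y∉hxs ∷ map-unique h uxs inj) y∷hxs⊆ys))
                      short

T-not⁻ : ∀ {b} → T (not b) → ¬ T b
T-not⁻ {false} _ ()

T-not⁺ : ∀ {b} → ¬ T b → T (not b)
T-not⁺ {false} _  = _
T-not⁺ {true}  ¬t = ¬t _

T-ext : ∀ {a b} → (T a → T b) → (T b → T a) → a ≡ b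
T-ext {false} {false} _ _ = refl
T-ext {false} {true}  _ g = contradiction (g _) λ ()
T-ext {true}  {false} f _ = contradiction (f _) λ ()
T-ext {true}  {true}  _ _ = refl

nonempty-member : ∀ {A : Set} {xs : List A} → 0 < length xs → ∃ λ x → x ∈ xs
nonempty-member {xs = x ∷ _} _ = x , here refl

fin-or-empty : ∀ m → Fin m ⊎ ¬ Fin m
fin-or-empty zero    = inj₂ λ ()
fin-or-empty (suc m) = inj₁ Fin.zero

module _ {P : ℕ → Set} (P? : Decidable P) where

  private
    leastBelow : ∀ k → (∃ λ L → P L × ∀ {ℓ} → ℓ < L → ¬ P ℓ) ⊎ (∀ {ℓ} → ℓ < k → ¬ P ℓ)
    leastBelow zero = inj₂ λ ()
    leastBelow (suc k) with leastBelow k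
    ... | inj₁ least = inj₁ least
    ... | inj₂ none with P? k
    ...   | yes pk = inj₁ (k , pk , none)
    ...   | no ¬pk = inj₂ λ ℓ<1+k → [ none , (λ { refl → ¬pk }) ] (m<1+n⇒m<n∨m≡n ℓ<1+k)

  least : ∀ {k} → P k → ∃ λ L → P L × ∀ {ℓ} → P ℓ → L ≤ ℓ
  least {k} pk with leastBelow (suc k)
  ... | inj₁ (L , pL , below) = L , pL , λ pℓ → ≮⇒≥ λ ℓ<L → below ℓ<L pℓ
  ... | inj₂ none = contradiction pk (none ≤-refl)

Odd : ℕ → Set
Odd ℓ = parity ℓ ≡ 1ℙ

parity-suc : ∀ n → parity (suc n) ≡ parity n ⁻¹
parity-suc = +-homo-+ 1

odd-2m+1 : ∀ m → Odd (suc (m + m))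
odd-2m+1 m = trans (parity-suc (m + m)) (cong _⁻¹ (trans (+-homo-+ m m) (p+p≡0ℙ (parity m))))

-- Going out along a walk of length a, across one edge, and back along a walk of length b
-- closes up with odd length when a and b have the same parity.
odd-closing : ∀ a b → parity a ≡ parity b → Odd (a + suc b)
odd-closing a b pa≡pb = begin
  parity (a + suc b)          ≡⟨ +-homo-+ a (suc b) ⟩
  parity a ℙ.+ parity (suc b) ≡⟨ cong₂ ℙ._+_ pa≡pb (parity-suc b) ⟩
  parity b ℙ.+ parity b ⁻¹    ≡⟨ p+p⁻¹≡1ℙ (parity b) ⟩
  1ℙ                          ∎
  where open ≡-Reasoning

parityBit : Parity → Bool
parityBit 0ℙ = false
parityBit 1ℙ = true

parityBit-injective : ∀ {p q} → parityBit p ≡ parityBit q → p ≡ q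
parityBit-injective {0ℙ} {0ℙ} _ = refl
parityBit-injective {1ℙ} {1ℙ} _ = refl

-- If p + q is odd then, for any j, one of j + q and j + p is odd
-- (their sum 2j + p + q is odd).
odd-split : ∀ p q j → Odd (p + q) → Odd (j + q) ⊎ Odd (j + p)
odd-split p q j odd = Sum.map (trans (+-homo-+ j q)) (trans (+-homo-+ j p))
  (split (parity p) (parity q) (parity j) (trans (sym (+-homo-+ p q)) odd))
  where
  split : ∀ x y z → x ℙ.+ y ≡ 1ℙ → z ℙ.+ y ≡ 1ℙ ⊎ z ℙ.+ x ≡ 1ℙ
  split 0ℙ 1ℙ 0ℙ _ = inj₁ refl
  split 0ℙ 1ℙ 1ℙ _ = inj₂ refl
  split 1ℙ 0ℙ 0ℙ _ = inj₂ refl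
  split 1ℙ 0ℙ 1ℙ _ = inj₁ refl

odd-cases : ∀ ℓ → Odd ℓ → ℓ ≡ 1 ⊎ ∃ λ k → ℓ ≡ 3 + (k + k)
odd-cases 1 _ = inj₁ refl
odd-cases (suc (suc ℓ)) odd with odd-cases ℓ odd
... | inj₁ refl = inj₂ (0 , refl)
... | inj₂ (k , refl) = inj₂ (suc k , cong (4 +_) (sym (+-suc k k)))

module Walks (X : Graph) where
  open Graph X renaming (sym to adj-comm)

  adj-sym : ∀ {u v} → T (adj u v) → T (adj v u)
  adj-sym {u} {v} = subst T (adj-comm u v)

  infixr 5 _∷_
  data Walk : ℕ → Fin n → Fin n → Set where
    []  : ∀ {v} → Walk 0 v v
    _∷_ : ∀ {k u v w} → T (adj u v) → Walk k v w → Walk (suc k) u w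

  _++_ : ∀ {p q x y z} → Walk p x y → Walk q y z → Walk (p + q) x z
  []      ++ r = r
  (e ∷ w) ++ r = e ∷ (w ++ r)

  _∷ʳ_ : ∀ {k u v w} → Walk k u v → T (adj v w) → Walk (suc k) u w
  []      ∷ʳ e′ = e′ ∷ []
  (e ∷ w) ∷ʳ e′ = e ∷ (w ∷ʳ e′)

  reverse : ∀ {k x y} → Walk k x y → Walk k y x
  reverse []      = []
  reverse (e ∷ w) = reverse w ∷ʳ adj-sym e

  unsnoc : ∀ {k u w} → Walk (suc k) u w → ∃ λ v → Walk k u v × T (adj v w)
  unsnoc (e ∷ [])          = _ , [] , e
  unsnoc (e ∷ w@(_ ∷ _)) with v , w′ , e′ ← unsnoc w = v , e ∷ w′ , e′

  split : ∀ p {q x z} → Walk (p + q) x z → ∃ λ y → Walk p x y × Walk q y z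
  split zero    w       = _ , [] , w
  split (suc p) (e ∷ w) with y , w₁ , w₂ ← split p w = y , e ∷ w₁ , w₂

  walk? : ∀ k v w → Dec (Walk k v w)
  walk? zero    v w = Dec.map′ (λ { refl → [] }) (λ { [] → refl }) (v ≟ w)
  walk? (suc k) v w = Dec.map′ (λ (u , e , r) → e ∷ r) (λ { (e ∷ r) → _ , e , r })
                                 (any? λ u → T? (adj v u) ×-dec walk? k u w)

  map-walk : ∀ {f} → IsEndomorphism X f → ∀ {k x y} → Walk k x y → Walk k (f x) (f y)
  map-walk hom []      = []
  map-walk hom (e ∷ w) = hom _ _ e ∷ map-walk hom w

  within⇒walk : ∀ k {v w} → T (within X k v w) → ∃ λ j → j ≤ k × Walk j v w
  within⇒walk zero {v} {w} t with v ≟ w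
  ... | yes refl = 0 , z≤n , []
  within⇒walk (suc k) {v} {w} t with Equivalence.to T-∨ t
  ... | inj₁ t′ with j , j≤k , r ← within⇒walk k t′ = j , m≤n⇒m≤1+n j≤k , r
  ... | inj₂ t′ with u , tu ← Any.satisfied (any⁻ _ (allFin n) t′)
                 with t″ , e ← Equivalence.to T-∧ tu
                 with j , j≤k , r ← within⇒walk k t″ = suc j , s≤s j≤k , r ∷ʳ e

  walk⇒within : ∀ k {j v w} → Walk j v w → j ≤ k → T (within X k v w)
  walk⇒within zero {v = v} [] z≤n = Equivalence.from T-≡ (dec-true (v ≟ v) refl)
  walk⇒within (suc k) {j} {v} {w} r j≤1+k with m≤n⇒m<n∨m≡n j≤1+k
  ... | inj₁ j<1+k = Equivalence.from T-∨ (inj₁ (walk⇒within k r (s≤s⁻¹ j<1+k)))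
  ... | inj₂ refl with u , r′ , e ← unsnoc r =
    Equivalence.from T-∨ (inj₂ (any⁺ _ (lose (∈-allFin u)
      (Equivalence.from T-∧ (walk⇒within k r′ ≤-refl , e)))))

  IsDistance : ℕ → Fin n → Fin n → Set
  IsDistance d v w = Walk d v w × (∀ {j} → Walk j v w → d ≤ j)

  isDist⇒distance : ∀ d {v w} → T (isDist X v w d) → IsDistance d v w
  isDist⇒distance zero t with _ , z≤n , r ← within⇒walk zero t = r , λ _ → z≤n
  isDist⇒distance (suc i) {v} {w} t = geodesic , shortest
    where
    shortest : ∀ {j} → Walk j v w → suc i ≤ j
    shortest r = ≰⇒> λ j≤i → T-not⁻ (proj₂ (Equivalence.to T-∧ t)) (walk⇒within i r j≤i)

    geodesic : Walk (suc i) v w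
    geodesic with j , j≤1+i , r ← within⇒walk (suc i) (proj₁ (Equivalence.to T-∧ t)) =
      subst (λ ℓ → Walk ℓ v w) (≤-antisym j≤1+i (shortest r)) r

  distance⇒isDist : ∀ d {v w} → IsDistance d v w → T (isDist X v w d)
  distance⇒isDist zero    (r , _)        = walk⇒within zero r z≤n
  distance⇒isDist (suc i) {v} {w} (r , shortest) =
    Equivalence.from T-∧ (walk⇒within (suc i) r ≤-refl , T-not⁺ unreachable)
    where
    unreachable : ¬ T (within X i v w)
    unreachable t with _ , j≤i , r′ ← within⇒walk i t = <⇒≱ (s≤s j≤i) (shortest r′)

  adj⇒distance1 : ∀ {u v} → T (adj u v) → IsDistance 1 u v
  adj⇒distance1 {u} e = e ∷ [] , λ { [] → ⊥-elim (subst T (loopless u) e) ; (_ ∷ _) → s≤s z≤n }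

  distance1⇒adj : ∀ {u v} → IsDistance 1 u v → T (adj u v)
  distance1⇒adj (e ∷ [] , _) = e

  neighbours : Fin n → List (Fin n)
  neighbours v = filter (λ u → T? (adj v u)) (allFin n)

  ∈-neighbours⁺ : ∀ {v u} → T (adj v u) → u ∈ neighbours v
  ∈-neighbours⁺ {v} {u} e = ∈-filter⁺ (λ u → T? (adj v u)) (∈-allFin u) e

  ∈-neighbours⁻ : ∀ {v u} → u ∈ neighbours v → T (adj v u)
  ∈-neighbours⁻ {v} u∈ = proj₂ (∈-filter⁻ (λ u → T? (adj v u)) {xs = allFin n} u∈)

  neighbours-unique : ∀ v → Unique (neighbours v)
  neighbours-unique v = Unique.filter⁺ (λ u → T? (adj v u)) (Unique.allFin⁺ n)

  degree≡count : ∀ v → length (neighbours v) ≡ count X v v 1 1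
  degree≡count v = cong length (filter-≐ (λ u → T? (adj v u)) (λ u → T? (isDist X v u 1 ∧ isDist X v u 1))
                                          (adj⇒dist1 , dist1⇒adj) (allFin n))
    where
    adj⇒dist1 : ∀ {u} → T (adj v u) → T (isDist X v u 1 ∧ isDist X v u 1)
    adj⇒dist1 e = let d = distance⇒isDist 1 (adj⇒distance1 e) in Equivalence.from T-∧ (d , d)

    dist1⇒adj : ∀ {u} → T (isDist X v u 1 ∧ isDist X v u 1) → T (adj v u)
    dist1⇒adj t = distance1⇒adj (isDist⇒distance 1 (proj₁ (Equivalence.to T-∧ t)))

  count-witness : ∀ {v w i j} → 0 < count X v w i j → ∃ λ u → IsDistance i v u × IsDistance j w u
  count-witness {v} {w} {i} {j} pos
    with u , u∈ ← nonempty-member pos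
    with t ← proj₂ (∈-filter⁻ (λ u → T? (isDist X v u i ∧ isDist X w u j)) {xs = allFin n} u∈) =
    u , isDist⇒distance i (proj₁ (Equivalence.to T-∧ t)) , isDist⇒distance j (proj₂ (Equivalence.to T-∧ t))

  witness-count : ∀ {v w i j u} → IsDistance i v u → IsDistance j w u → 0 < count X v w i j
  witness-count {v} {w} {i} {j} {u} dᵢ dⱼ =
    filter-some (λ u → T? (isDist X v u i ∧ isDist X w u j))
                (lose (∈-allFin u) (Equivalence.from T-∧ (distance⇒isDist i dᵢ , distance⇒isDist j dⱼ)))

  HasIntersectionNumbers : (ℕ → ℕ → ℕ → ℕ) → Set
  HasIntersectionNumbers p = ∀ i j d v w → T (isDist X v w d) → count X v w i j ≡ p i j d

  distanceRegular⇒regular : ∀ {p} → HasIntersectionNumbers p → ∀ v → length (neighbours v) ≡ p 1 1 0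
  distanceRegular⇒regular intersection v =
    trans (degree≡count v) (intersection 1 1 0 v v (distance⇒isDist 0 {v} ([] , λ _ → z≤n)))

  common-neighbours⇒distance2 : TriangleFree X → ∀ {u a b} → T (adj u a) → T (adj u b) → a ≢ b →
                                IsDistance 2 a b
  common-neighbours⇒distance2 tf {u} {a} {b} ea eb a≢b = adj-sym ea ∷ eb ∷ [] , shortest
    where
    shortest : ∀ {j} → Walk j a b → 2 ≤ j
    shortest []           = contradiction refl a≢b
    shortest (e ∷ [])     = ⊥-elim (tf u a b (ea , e , eb))
    shortest (_ ∷ _ ∷ _)  = s≤s (s≤s z≤n)

module OddClosedWalks (X : Graph) where
  open Graph X using (n; adj; loopless)
  open Walks X

  OddClosedWalk : ℕ → Set
  OddClosedWalk ℓ = Odd ℓ × ∃ λ x → Walk ℓ x x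

  oddClosedWalk? : Decidable OddClosedWalk
  oddClosedWalk? ℓ = (parity ℓ ℙ≟ 1ℙ) ×-dec any? (λ x → walk? ℓ x x)

  -- Colouring each vertex by the parity of a walk to it from a base vertex either
  -- 2-colours a connected graph or exhibits an odd closed walk.
  module ParityColouring (connected : Connected X) (root : Fin n) where
    walkFromRoot : ∀ v → ∃ λ j → Walk j root v
    walkFromRoot v with k , t ← connected root v with j , _ , r ← within⇒walk k t = j , r

    depth : Fin n → ℕ
    depth v = proj₁ (walkFromRoot v)

    colour : Fin n → Bool
    colour v = parityBit (parity (depth v))

    oddClosedWalk-or-bipartite : (∃ OddClosedWalk) ⊎ Bipartite X
    oddClosedWalk-or-bipartite with any? (λ u → any? λ v → T? (adj u v) ×-dec (colour u Bool.≟ colour v))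
    ... | no noMonochromaticEdge = inj₂ (colour , λ u v e same → noMonochromaticEdge (u , v , e , same))
    ... | yes (u , v , e , same) = inj₁ (_ , odd-closing (depth u) (depth v) (parityBit-injective same) , root ,
                                         proj₂ (walkFromRoot u) ++ (e ∷ reverse (proj₂ (walkFromRoot v))))

  -- a connected non-bipartite graph has an odd closed walk (it has a vertex, since the
  -- empty graph is bipartite)
  nonBipartite⇒oddClosedWalk : Connected X → ¬ Bipartite X → ∃ OddClosedWalk
  nonBipartite⇒oddClosedWalk connected nonBip with fin-or-empty n
  ... | inj₁ root  = [ id , (λ bip → contradiction bip nonBip) ]
                       (ParityColouring.oddClosedWalk-or-bipartite connected root)
  ... | inj₂ empty = contradiction ((λ v → ⊥-elim (empty v)) , λ u → ⊥-elim (empty u)) nonBip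

  -- in a triangle-free graph odd closed walks have length 2k + 3 with k ≥ 1: lengths 1 and 3
  -- would give a loop or a triangle
  triangleFree⇒oddLength : TriangleFree X → ∀ {ℓ} → OddClosedWalk ℓ →
                           ∃ λ k → 1 ≤ k × ℓ ≡ 3 + (k + k)
  triangleFree⇒oddLength tf {ℓ} (odd , x , w) with odd-cases ℓ odd | w
  ... | inj₁ refl              | e ∷ []          = ⊥-elim (subst T (loopless x) e)
  ... | inj₂ (zero , refl)     | e₀ ∷ e₁ ∷ e₂ ∷ [] = ⊥-elim (tf x _ _ (e₀ , e₁ , adj-sym e₂))
  ... | inj₂ (suc k , refl)    | _               = suc k , s≤s z≤n , refl

  oddGirth : Connected X → ¬ Bipartite X → TriangleFree X →
             ∃ λ k → 1 ≤ k × (∃ λ x → Walk (3 + (k + k)) x x) ×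
                     (∀ {ℓ x} → Walk ℓ x x → Odd ℓ → 3 + (k + k) ≤ ℓ)
  oddGirth connected nonBip tf
    with _ , (oddL , x , C) , minimal ← least oddClosedWalk? (proj₂ (nonBipartite⇒oddClosedWalk connected nonBip))
    with k , 1≤k , refl ← triangleFree⇒oddLength tf (oddL , x , C) =
    k , 1≤k , (x , C) , λ w odd → minimal (odd , _ , w)

-- Geodesic arcs of a shortest odd closed walk: if every odd closed walk has length at
-- least L = 2k + 3, then of two walks between x and y of total length L, the shorter
-- one realises the distance (a shortcut would close up a shorter odd walk).
module ShortestOddCycle (X : Graph) (k : ℕ)
                        (shortest : ∀ {ℓ x} → Walks.Walk X ℓ x x → Odd ℓ → 3 + (k + k) ≤ ℓ) where
  open Graph X using (adj)
  open Walks X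

  arc-geodesic : ∀ {p q x y} → Walk p x y → Walk q x y → p + q ≡ 3 + (k + k) → p ≤ q → IsDistance p x y
  arc-geodesic {p} {q} {x} {y} P Q p+q≡L p≤q = P , λ {j} R → p≤j j R
    where
    p≤j : ∀ j → Walk j x y → p ≤ j
    p≤j j R with odd-split p q j (subst Odd (sym p+q≡L) (odd-2m+1 k))
    ... | inj₁ odd = +-cancelʳ-≤ q p j (subst (_≤ j + q) (sym p+q≡L) (shortest (R ++ reverse Q) odd))
    ... | inj₂ odd = ≤-trans p≤q (+-cancelˡ-≤ p q j
                       (subst₂ _≤_ (sym p+q≡L) (+-comm j p) (shortest (R ++ reverse P) odd)))

  endomorphism-separates : ∀ {f} → IsEndomorphism X f → ∀ {ℓ a b} → Walk ℓ a b → Odd ℓ →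
                           ℓ < 3 + (k + k) → f a ≢ f b
  endomorphism-separates {f} hom {ℓ} {b = b} w odd short fa≡fb =
    <⇒≱ short (shortest (subst (λ v → Walk ℓ v (f b)) fa≡fb (map-walk hom w)) odd)

  -- Cutting a closed walk c′ → c → z → c′ of length 2k + 3 (k ≥ 1) into arcs of lengths
  -- 2, k + 1 and k gives c′, c at distance 2 and z at distances k and k + 1 from them.
  cycle-witness : 1 ≤ k → ∀ {x} → Walk (3 + (k + k)) x x →
                  ∃ λ c′ → ∃ λ c → ∃ λ z →
                    IsDistance 2 c′ c × IsDistance k c′ z × IsDistance (suc k) c z
  cycle-witness 1≤k (e₀ ∷ e₁ ∷ R) with z , A , B ← split (suc k) R =
    _ , _ , z ,
    arc-geodesic (e₀ ∷ e₁ ∷ []) (reverse R) refl (s≤s (≤-trans 1≤k (m≤m+n k k))) ,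
    arc-geodesic (reverse B) (e₀ ∷ e₁ ∷ A) (arcLengths₁ k) (m≤n+m k 3) ,
    arc-geodesic A (adj-sym e₁ ∷ adj-sym e₀ ∷ reverse B) (arcLengths₂ k) (n≤1+n (suc k))
    where
    arcLengths₁ : ∀ m → m + (3 + m) ≡ 3 + (m + m)
    arcLengths₁ = solve-∀

    arcLengths₂ : ∀ m → suc m + (2 + m) ≡ 3 + (m + m)
    arcLengths₂ = solve-∀

  -- With intersection numbers p, the witness on a shortest odd closed walk of length
  -- 2k + 3 transfers to every pair at distance 2, which is then joined by an odd walk
  -- of length 2k + 1; so no endomorphism identifies two vertices at distance 2.
  module DistanceRegularity {p : ℕ → ℕ → ℕ → ℕ} (intersection : HasIntersectionNumbers p)
           (1≤k : 1 ≤ k) {x} (C : Walk (3 + (k + k)) x x) where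

    distance2⇒count-positive : ∀ {a b} → IsDistance 2 a b → 0 < count X a b k (suc k)
    distance2⇒count-positive {a} {b} dab with c′ , c , z , dc′c , dc′z , dcz ← cycle-witness 1≤k C =
      subst (0 <_) (trans (intersection k (suc k) 2 c′ c (distance⇒isDist 2 dc′c))
                          (sym (intersection k (suc k) 2 a b (distance⇒isDist 2 dab))))
            (witness-count dc′z dcz)

    distance2⇒oddWalk : ∀ {a b} → IsDistance 2 a b → Walk (suc (k + k)) b a
    distance2⇒oddWalk dab
      with _ , (ay , _) , (by , _) ← count-witness {i = k} {j = suc k} (distance2⇒count-positive dab) =
      by ++ reverse ay

    -- that walk is odd and shorter than the odd girth
    distance2-separated : ∀ {f} → IsEndomorphism X f → ∀ {a b} → IsDistance 2 a b → f b ≢ f a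
    distance2-separated hom dab = endomorphism-separates hom (distance2⇒oddWalk dab) (odd-2m+1 k) (n≤1+n _)

    locally-injective : TriangleFree X → ∀ {f} → IsEndomorphism X f →
                        ∀ {u a b} → T (adj u a) → T (adj u b) → f a ≡ f b → a ≡ b
    locally-injective tf hom {a = a} {b} ea eb fa≡fb with a ≟ b
    ... | yes a≡b = a≡b
    ... | no  a≢b =
      contradiction (sym fa≡fb) (distance2-separated hom (common-neighbours⇒distance2 tf ea eb a≢b))

-- Counting shows that f maps each neighbourhood N(u) onto N(f u); so the image of f is
-- closed under taking neighbours, hence everything by connectedness. A surjection of the
-- finite vertex set onto itself is injective, and mapping N(u) onto N(f u) also makes f
-- reflect adjacency.
module LocallyInjectiveEndomorphism
         (X : Graph) (connected : Connected X) {d : ℕ} (regular : ∀ v → length (Walks.neighbours X v) ≡ d)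
         {f : Fin (Graph.n X) → Fin (Graph.n X)} (hom : IsEndomorphism X f)
         (locally-injective : ∀ {u a b} → T (Graph.adj X u a) → T (Graph.adj X u b) → f a ≡ f b → a ≡ b)
         where
  open Graph X using (n; adj)
  open Walks X
  open Counting (_≟_ {n})

  -- f is injective on N(u) and |N(u)| = |N(f u)|, so f maps N(u) onto N(f u)
  neighbourhood-onto : ∀ {u w} → T (adj (f u) w) → ∃ λ a → T (adj u a) × f a ≡ w
  neighbourhood-onto {u} e
    with a , a∈ , fa≡w ← injectiveOn⇒covers f (neighbours-unique u)
                           (λ a∈ b∈ → locally-injective (∈-neighbours⁻ a∈) (∈-neighbours⁻ b∈))
                           (∈-neighbours⁺ ∘ hom _ _ ∘ ∈-neighbours⁻)
                           (≤-reflexive (trans (regular (f u)) (sym (regular u))))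
                           (∈-neighbours⁺ e) =
    a , ∈-neighbours⁻ a∈ , fa≡w

  image-closed : ∀ {j v w} → Walk j (f v) w → ∃ λ a → f a ≡ w
  image-closed {v = v} [] = v , refl
  image-closed (e ∷ r) with a , _ , refl ← neighbourhood-onto e = image-closed r

  surjective : ∀ w → ∃ λ v → f v ≡ w
  surjective w with k , t ← connected (f w) w with _ , _ , r ← within⇒walk k t = image-closed r

  section : Fin n → Fin n
  section w = proj₁ (surjective w)

  f∘section : ∀ w → f (section w) ≡ w
  f∘section w = proj₂ (surjective w)

  section-injective : InjectiveOn section (allFin n)
  section-injective {a} {b} _ _ eq = trans (sym (f∘section a)) (trans (cong f eq) (f∘section b))

  -- being injective, the section covers the finite vertex set, so it is a two-sided inverse
  section∘f : ∀ v → section (f v) ≡ v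
  section∘f v with w , _ , refl ← injectiveOn⇒covers section (Unique.allFin⁺ n) section-injective
                                   (λ {w} _ → ∈-allFin (section w)) ≤-refl (∈-allFin v) =
    cong section (f∘section w)

  injective : ∀ {u v} → f u ≡ f v → u ≡ v
  injective {u} {v} fu≡fv = trans (sym (section∘f u)) (trans (cong section fu≡fv) (section∘f v))

  reflects-adjacency : ∀ u v → T (adj (f u) (f v)) → T (adj u v)
  reflects-adjacency u v e with a , ua , fa≡fv ← neighbourhood-onto e = subst (T ∘ adj u) (injective fa≡fv) ua

  automorphism : IsAutomorphism X f
  automorphism = (injective , strictlySurjective⇒surjective surjective) ,
                 λ u v → T-ext (reflects-adjacency u v) (hom u v)

mainTheorem9 : (X : Graph) → DistanceRegular X → ¬ Bipartite X → TriangleFree X → IsCore X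
mainTheorem9 X (connected , _ , intersection) nonBip tf f hom
  with k , 1≤k , (_ , C) , shortest ← OddClosedWalks.oddGirth X connected nonBip tf =
  LocallyInjectiveEndomorphism.automorphism X connected (Walks.distanceRegular⇒regular X intersection) hom
    (ShortestOddCycle.DistanceRegularity.locally-injective X k shortest intersection 1≤k C tf hom)
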